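{- For every $n\ge 1$, Snort played on the (initially uncoloured, untinted) graph $G_n$ is a first player win, where $G_n$ is obtained from $T_{n,3}$ by adding three new vertices $L_1, R_2, R_3$ and the edges $L_1\sim(1,1)$, $L_1\sim(1,2)$, $(n,1)\sim R_2$, $(n,2)\sim R_2$, $(n,2)\sim R_3$, $(n,3)\sim R_3$, $R_2\sim R_3$.
   Context: Snort is a two-player game (players Left and Right) played on a finite simple graph. The players alternately colour a previously uncoloured vertex, Left in blue and Right in red, subject to the rule that no two adjacent vertices may receive opposite colours. Normal play: a player who cannot move on their turn loses. A game is a "first player win" if the player who moves first has a winning strategy, regardless of whether that player is Left or Right. $T_{n,3}$ is the graph with vertex set $\{(i,j): 1\le i\le n,\ 1\le j\le 3\}$ and edges $(i,j)\sim(i+1,j)$ for $1\le i\le n-1$, $1\le j\le 3$; $(i,j)\sim(i,j+1)$ for $1\le i\le n$, $1\le j\le 2$; and $(i,j)\sim(i+1,j+1)$ for $1\le i\le n-1$, $1\le j\le 2$. -}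

module Defs where

open import Data.Nat using (ℕ; zero; suc)
open import Data.Fin using (Fin; toℕ)
import Data.Fin.Properties as FinP
open import Data.Maybe using (Maybe; just; nothing)
open import Data.Product using (Σ; _×_; _,_)
open import Data.Sum using (_⊎_)
open import Data.Empty using (⊥)
open import Relation.Nullary using (¬_; Dec; yes; no)
open import Relation.Binary.PropositionalEquality using (_≡_; refl; cong; cong₂)
open import Relation.Binary.Definitions using (DecidableEquality)

data Player : Set where
  Left Right : Player

opp : Player → Player
opp Left  = Right
opp Right = Left

module Snort {V : Set} (_≟_ : DecidableEquality V) (Adj : V → V → Set) where

  -- a position: each vertex is uncoloured (nothing) or coloured by a player
  -- (Left = blue, Right = red)
  Colouring : Set
  Colouring = V → Maybe Player

  empty : Colouring
  empty _ = nothing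

  paint : Colouring → V → Player → Colouring
  paint c v p u with u ≟ v
  ... | yes _ = just p
  ... | no  _ = c u

  Legal : Player → Colouring → V → Set
  Legal p c v = (c v ≡ nothing) × ((u : V) → Adj v u → ¬ (c u ≡ just (opp p)))

  -- WinsMoving p c : player p, about to move in position c, has a winning
  -- strategy (normal play: a player unable to move loses).
  -- p has a legal move v such that, for every legal reply w of the opponent,
  -- p again wins moving from the resulting position.  (If the opponent has
  -- no legal reply, the opponent loses.)
  data WinsMoving (p : Player) (c : Colouring) : Set where
    win : (v : V) → Legal p c v →
          ((w : V) → Legal (opp p) (paint c v p) w →
             WinsMoving p (paint (paint c v p) w (opp p))) →
          WinsMoving p c

  FirstPlayerWin : Set
  FirstPlayerWin = WinsMoving Left empty × WinsMoving Right empty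

-- vertices: cell i j is (i+1, j+1) (0-indexed Fin), plus L1, R2, R3
data GV (n : ℕ) : Set where
  cell : Fin n → Fin 3 → GV n
  L1 R2 R3 : GV n

data GEdge (n : ℕ) : GV n → GV n → Set where
  horiz : (i i' : Fin n) (j : Fin 3) → suc (toℕ i) ≡ toℕ i' →
          GEdge n (cell i j) (cell i' j)
  vert  : (i : Fin n) (j j' : Fin 3) → suc (toℕ j) ≡ toℕ j' →
          GEdge n (cell i j) (cell i j')
  diag  : (i i' : Fin n) (j j' : Fin 3) → suc (toℕ i) ≡ toℕ i' →
          suc (toℕ j) ≡ toℕ j' → GEdge n (cell i j) (cell i' j')
  L1-1  : (i : Fin n) → toℕ i ≡ 0 → GEdge n L1 (cell i (Fin.zero))
  L1-2  : (i : Fin n) → toℕ i ≡ 0 → GEdge n L1 (cell i (Fin.suc Fin.zero))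
  R2-1  : (i : Fin n) → suc (toℕ i) ≡ n → GEdge n (cell i Fin.zero) R2
  R2-2  : (i : Fin n) → suc (toℕ i) ≡ n → GEdge n (cell i (Fin.suc Fin.zero)) R2
  R3-2  : (i : Fin n) → suc (toℕ i) ≡ n → GEdge n (cell i (Fin.suc Fin.zero)) R3
  R3-3  : (i : Fin n) → suc (toℕ i) ≡ n →
          GEdge n (cell i (Fin.suc (Fin.suc Fin.zero))) R3
  R2-R3 : GEdge n R2 R3

GAdj : (n : ℕ) → GV n → GV n → Set
GAdj n u v = GEdge n u v ⊎ GEdge n v u

_≟G_ : {n : ℕ} → DecidableEquality (GV n)
cell i j ≟G cell i' j' with i FinP.≟ i' | j FinP.≟ j'
... | yes refl | yes refl = yes refl
... | no ne | _ = no λ { refl → ne refl }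
... | yes _ | no ne = no λ { refl → ne refl }
cell _ _ ≟G L1 = no λ ()
cell _ _ ≟G R2 = no λ ()
cell _ _ ≟G R3 = no λ ()
L1 ≟G cell _ _ = no λ ()
L1 ≟G L1 = yes refl
L1 ≟G R2 = no λ ()
L1 ≟G R3 = no λ ()
R2 ≟G cell _ _ = no λ ()
R2 ≟G L1 = no λ ()
R2 ≟G R2 = yes refl
R2 ≟G R3 = no λ ()
R3 ≟G cell _ _ = no λ ()
R3 ≟G L1 = no λ ()
R3 ≟G R2 = no λ ()
R3 ≟G R3 = yes refl

SnortG-FirstPlayerWin : ℕ → Set
SnortG-FirstPlayerWin n = Snort.FirstPlayerWin (_≟G_ {n}) (GAdj n)

module Submission where

-- The first player colours the middle vertex of a central column and then answers every move by its
-- mate under a pairing of the remaining board: a vertex in column x < m is paired with the vertex in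
-- the same row d columns to the right, where m + d is the number of columns. Only the centre and some
-- of its neighbours stay unpaired, and the opponent can never colour those. The pairing never pairs
-- neighbours and maps edges between paired vertices to edges, so the mate of a legal move is again
-- legal for the mirroring player, who therefore never runs out of moves.

open import Defs
open import Data.Nat
  using (ℕ; zero; suc; _+_; _∸_; _≤_; _<_; z≤n; s≤s; _<?_; _≤?_; ∣_-_∣; ⌊_/2⌋; ⌈_/2⌉)
open import Data.Nat.Properties
open import Data.Fin using (Fin; toℕ; fromℕ<) renaming (zero to fz; suc to fs)
open import Data.Fin.Properties using (toℕ-injective; toℕ<n; fromℕ<-toℕ; toℕ-fromℕ<)
open import Data.List using (List; []; _∷_; cartesianProductWith; allFin)
open import Data.List.Membership.Propositional using (_∈_)
open import Data.List.Membership.Propositional.Properties using (∈-cartesianProductWith⁺; ∈-allFin)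
open import Data.List.Relation.Unary.Any using (here; there)
open import Data.Maybe using (Maybe; just; nothing)
open import Data.Maybe.Properties using (just-injective)
open import Data.Product using (Σ; _×_; _,_; proj₁; proj₂)
open import Data.Sum using (_⊎_; inj₁; inj₂)
open import Data.Empty using (⊥-elim)
open import Relation.Nullary using (¬_; yes; no)
open import Relation.Binary.PropositionalEquality
  using (_≡_; _≢_; refl; sym; trans; cong; cong₂; subst; subst₂)
open import Relation.Binary.Definitions using (DecidableEquality)

opp-involutive : ∀ p → opp (opp p) ≡ p
opp-involutive Left  = refl
opp-involutive Right = refl

opp-≢ : ∀ p → p ≢ opp p
opp-≢ Left  ()
opp-≢ Right ()

module PairingStrategy {V : Set} (_≟_ : DecidableEquality V) (Adj : V → V → Set) where
  open Snort _≟_ Adj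

  paint-same : ∀ c v q → paint c v q v ≡ just q
  paint-same c v q with v ≟ v
  ... | yes _ = refl
  ... | no v≢v = ⊥-elim (v≢v refl)

  paint-other : ∀ c {v} q {u} → u ≢ v → paint c v q u ≡ c u
  paint-other c {v} q {u} u≢v with u ≟ v
  ... | yes u≡v = ⊥-elim (u≢v u≡v)
  ... | no _ = refl

  paint-just : ∀ c v q u {r} → paint c v q u ≡ just r → (u ≡ v × q ≡ r) ⊎ c u ≡ just r
  paint-just c v q u e with u ≟ v
  ... | yes u≡v = inj₁ (u≡v , just-injective e)
  ... | no _ = inj₂ e

  _⊑_ : Colouring → Colouring → Set
  c ⊑ c' = ∀ x {r} → c x ≡ just r → c' x ≡ just r

  ⊑-trans : ∀ {c c' c''} → c ⊑ c' → c' ⊑ c'' → c ⊑ c''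
  ⊑-trans c⊑c' c'⊑c'' x e = c'⊑c'' x (c⊑c' x e)

  paint-⊑ : ∀ c {v} q → c v ≡ nothing → c ⊑ paint c v q
  paint-⊑ c {v} q cv≡nothing x {r} cx with x ≟ v
  ... | yes refl with trans (sym cx) cv≡nothing
  ...   | ()
  paint-⊑ c {v} q cv≡nothing x {r} cx | no _ = cx

  ⊑-nothing : ∀ {c c'} → c ⊑ c' → ∀ x → c' x ≡ nothing → c x ≡ nothing
  ⊑-nothing {c} c⊑c' x c'x with c x in cx
  ... | nothing = refl
  ... | just _ with trans (sym (c⊑c' x cx)) c'x
  ...   | ()

  uncoloured : Colouring → List V → ℕ
  uncoloured c [] = 0
  uncoloured c (x ∷ xs) with c x
  ... | nothing = suc (uncoloured c xs)
  ... | just _  = uncoloured c xs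

  uncoloured-mono : ∀ {c c'} → c ⊑ c' → ∀ xs → uncoloured c' xs ≤ uncoloured c xs
  uncoloured-mono {c} {c'} c⊑c' [] = z≤n
  uncoloured-mono {c} {c'} c⊑c' (x ∷ xs) with c x in cx | c' x in c'x
  ... | nothing | nothing = s≤s (uncoloured-mono c⊑c' xs)
  ... | nothing | just _  = m≤n⇒m≤1+n (uncoloured-mono c⊑c' xs)
  ... | just _  | just _  = uncoloured-mono c⊑c' xs
  ... | just _  | nothing with trans (sym cx) (⊑-nothing c⊑c' x c'x)
  ...   | ()

  uncoloured-strict : ∀ {c c'} → c ⊑ c' → ∀ {w r} xs → w ∈ xs → c w ≡ nothing → c' w ≡ just r →
                      uncoloured c' xs < uncoloured c xs
  uncoloured-strict {c} {c'} c⊑c' (x ∷ xs) (here refl) cw c'w with c x | c' x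
  ... | nothing | just _  = s≤s (uncoloured-mono c⊑c' xs)
  uncoloured-strict c⊑c' (x ∷ xs) (here refl) cw ()  | nothing | nothing
  uncoloured-strict c⊑c' (x ∷ xs) (here refl) () c'w | just _  | _
  uncoloured-strict {c} {c'} c⊑c' (x ∷ xs) (there w∈xs) cw c'w with c x in cx | c' x in c'x
  ... | nothing | nothing = s≤s (uncoloured-strict c⊑c' xs w∈xs cw c'w)
  ... | nothing | just _  = m≤n⇒m≤1+n (uncoloured-strict c⊑c' xs w∈xs cw c'w)
  ... | just _  | just _  = uncoloured-strict c⊑c' xs w∈xs cw c'w
  ... | just _  | nothing with trans (sym cx) (⊑-nothing c⊑c' x c'x)
  ...   | ()

  legal-≢-coloured : ∀ {q c u v r} → Legal q c u → c v ≡ just r → u ≢ v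
  legal-≢-coloured (cu , _) cv refl with trans (sym cu) cv
  ... | ()

  legal-retract : ∀ {q c c' u} → c ⊑ c' → Legal q c' u → Legal q c u
  legal-retract {u = u} c⊑c' (c'u , free) = ⊑-nothing c⊑c' u c'u , λ x adj cx → free x adj (c⊑c' x cx)

  record IsPairing (mate : V → Maybe V) : Set where
    field
      mate-irrefl      : ∀ {x y} → mate x ≡ just y → y ≢ x
      mate-sym         : ∀ {x y} → mate x ≡ just y → mate y ≡ just x
      mate-nonadjacent : ∀ {x y} → mate x ≡ just y → ¬ Adj y x
      mate-adjacent    : ∀ {x y x' y'} → mate x ≡ just x' → mate y ≡ just y' → Adj x y → Adj x' y'

    mate-injective : ∀ {x y z} → mate x ≡ just z → mate y ≡ just z → x ≡ y
    mate-injective mx my = just-injective (trans (sym (mate-sym mx)) (mate-sym my))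

  module Mirror {mate : V → Maybe V} (pairing : IsPairing mate)
                (vs : List V) (complete : ∀ v → v ∈ vs) (p : Player) where
    open IsPairing pairing

    MirrorInvariant : Colouring → Set
    MirrorInvariant c = ∀ u → Legal (opp p) c u → Σ V λ u' → mate u ≡ just u' × Legal p c u'

    exchange : Colouring → V → V → Colouring
    exchange c w w' = paint (paint c w (opp p)) w' p

    reply-legal : ∀ {c w w'} → mate w ≡ just w' → Legal p c w' → Legal p (paint c w (opp p)) w'
    reply-legal {c} {w} {w'} mw (cw' , free) =
      trans (paint-other c (opp p) (mate-irrefl mw)) cw' , free₁
      where
        free₁ : ∀ x → Adj w' x → paint c w (opp p) x ≢ just (opp p)
        free₁ x adj e with paint-just c w (opp p) x e
        ... | inj₁ (refl , _) = mate-nonadjacent mw adj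
        ... | inj₂ cx = free x adj cx

    exchange-⊑ : ∀ {c w w'} → Legal (opp p) c w → mate w ≡ just w' → Legal p c w' →
                 c ⊑ exchange c w w'
    exchange-⊑ {c} {w} lw mw lw' =
      ⊑-trans (paint-⊑ c (opp p) (proj₁ lw)) (paint-⊑ (paint c w (opp p)) p (proj₁ (reply-legal mw lw')))

    exchange-move : ∀ c {w w'} → mate w ≡ just w' → exchange c w w' w ≡ just (opp p)
    exchange-move c {w} mw =
      trans (paint-other (paint c w (opp p)) p (λ w≡w' → mate-irrefl mw (sym w≡w')))
            (paint-same c w (opp p))

    exchange-reply : ∀ c w w' → exchange c w w' w' ≡ just (opp (opp p))
    exchange-reply c w w' = trans (paint-same (paint c w (opp p)) w' p) (cong just (sym (opp-involutive p)))

    mirror-legal : ∀ {c w w' u u'} → Legal (opp p) c w → mate w ≡ just w' → Legal p c w' →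
                   Legal (opp p) (exchange c w w') u → mate u ≡ just u' → Legal p c u' →
                   Legal p (exchange c w w') u'
    mirror-legal {c} {w} {w'} {u} {u'} lw mw lw' lu mu lu' = c₂u' , free₂
      where
        c₁ = paint c w (opp p)
        u'≢w' : u' ≢ w'
        u'≢w' refl = legal-≢-coloured lu (exchange-move c mw) (mate-injective mu mw)
        u'≢w : u' ≢ w
        u'≢w refl = legal-≢-coloured lu (exchange-reply c w w') (just-injective (trans (sym (mate-sym mu)) mw))
        c₂u' : exchange c w w' u' ≡ nothing
        c₂u' = trans (paint-other c₁ p u'≢w') (trans (paint-other c (opp p) u'≢w) (proj₁ lu'))
        free₂ : ∀ x → Adj u' x → exchange c w w' x ≢ just (opp p)
        free₂ x adj e with paint-just c₁ w' p x e
        ... | inj₁ (_ , p≡opp) = opp-≢ p p≡opp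
        ... | inj₂ c₁x with paint-just c w (opp p) x c₁x
        ...   | inj₁ (refl , _) = proj₂ lu w' (mate-adjacent (mate-sym mu) mw adj) (exchange-reply c w w')
        ...   | inj₂ cx = proj₂ lu' x adj cx

    invariant-step : ∀ {c w w'} → MirrorInvariant c → Legal (opp p) c w → mate w ≡ just w' →
                     Legal p c w' → MirrorInvariant (exchange c w w')
    invariant-step inv lw mw lw' u lu with inv u (legal-retract (exchange-⊑ lw mw lw') lu)
    ... | u' , mu , lu' = u' , mu , mirror-legal lw mw lw' lu mu lu'

    mirror-responds : ∀ k c → uncoloured c vs < k → MirrorInvariant c →
                      ∀ w → Legal (opp p) c w → WinsMoving p (paint c w (opp p))
    mirror-responds zero c () inv w lw
    mirror-responds (suc k) c bound inv w lw with inv w lw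
    ... | w' , mw , lw' =
      win w' (reply-legal mw lw') (mirror-responds k (exchange c w w') fewer (invariant-step inv lw mw lw'))
      where
        fewer : uncoloured (exchange c w w') vs < k
        fewer = <-≤-trans
          (uncoloured-strict (exchange-⊑ lw mw lw') vs (complete w) (proj₁ lw) (exchange-move c mw))
          (≤-pred bound)

    legal-after-opening : ∀ {v₀ u} → u ≢ v₀ → Legal p (paint empty v₀ p) u
    legal-after-opening {v₀} {u} u≢v₀ = paint-other empty p u≢v₀ , free
      where
        free : ∀ x → Adj u x → paint empty v₀ p x ≢ just (opp p)
        free x _ e with paint-just empty v₀ p x e
        ... | inj₁ (_ , p≡opp) = opp-≢ p p≡opp
        ... | inj₂ ()

    opening-invariant : ∀ v₀ → mate v₀ ≡ nothing → (∀ u → mate u ≡ nothing → u ≡ v₀ ⊎ Adj u v₀) →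
                        MirrorInvariant (paint empty v₀ p)
    opening-invariant v₀ mv₀ unmatched u lu with mate u in mu
    ... | just u' = u' , refl , legal-after-opening u'≢v₀
      where
        u'≢v₀ : u' ≢ v₀
        u'≢v₀ refl with trans (sym (mate-sym mu)) mv₀
        ... | ()
    ... | nothing with unmatched u mu
    ...   | inj₁ u≡v₀ = ⊥-elim (legal-≢-coloured lu (paint-same empty v₀ p) u≡v₀)
    ...   | inj₂ adj =
      ⊥-elim (proj₂ lu v₀ adj (trans (paint-same empty v₀ p) (cong just (sym (opp-involutive p)))))

    pairing-wins : ∀ v₀ → mate v₀ ≡ nothing → (∀ u → mate u ≡ nothing → u ≡ v₀ ⊎ Adj u v₀) →
                   WinsMoving p empty
    pairing-wins v₀ mv₀ unmatched =
      win v₀ (refl , λ _ _ ()) (mirror-responds _ (paint empty v₀ p) ≤-refl (opening-invariant v₀ mv₀ unmatched))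

module ColumnShift (m d : ℕ) (m≤d : m ≤ d) where

  shift : ℕ → Maybe ℕ
  shift x with x <? m
  ... | yes _ = just (x + d)
  ... | no _ with d ≤? x
  ...   | yes _ = just (x ∸ d)
  ...   | no _  = nothing

  shift-spec : ∀ x {y} → shift x ≡ just y → (x < m × y ≡ x + d) ⊎ (m ≤ x × x ≡ y + d)
  shift-spec x e with x <? m
  shift-spec x refl | yes x<m = inj₁ (x<m , refl)
  ... | no x≮m with d ≤? x
  shift-spec x refl | no x≮m | yes d≤x = inj₂ (≮⇒≥ x≮m , sym (m∸n+n≡m d≤x))
  shift-spec x ()   | no x≮m | no _

  shift-lower : ∀ {x} → x < m → shift x ≡ just (x + d)
  shift-lower {x} x<m with x <? m
  ... | yes _ = refl
  ... | no x≮m = ⊥-elim (x≮m x<m)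

  shift-upper : ∀ y → shift (y + d) ≡ just y
  shift-upper y with y + d <? m
  ... | yes y+d<m = ⊥-elim (<-irrefl refl (<-≤-trans y+d<m (≤-trans m≤d (m≤n+m d y))))
  ... | no _ with d ≤? y + d
  ...   | yes _ = cong just (m+n∸n≡m y d)
  ...   | no d≰y+d = ⊥-elim (d≰y+d (m≤n+m d y))

  shift-undefined : ∀ x → shift x ≡ nothing → m ≤ x × x < d
  shift-undefined x e with x <? m
  shift-undefined x () | yes _
  ... | no x≮m with d ≤? x
  shift-undefined x () | no _ | yes _
  ... | no d≰x = ≮⇒≥ x≮m , ≰⇒> d≰x

  shift-distance : ∀ x {y} → shift x ≡ just y → ∣ x - y ∣ ≡ d
  shift-distance x {y} e with shift-spec x e
  ... | inj₁ (_ , refl) = ∣m-m+n∣≡n x d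
  ... | inj₂ (_ , refl) = trans (∣-∣-comm (y + d) y) (∣m-m+n∣≡n y d)

  shift-involutive : ∀ x {y} → x < m + d → shift x ≡ just y → shift y ≡ just x
  shift-involutive x {y} x<m+d e with shift-spec x e
  ... | inj₁ (_ , refl) = shift-upper x
  ... | inj₂ (_ , refl) = shift-lower (+-cancelʳ-< d y m x<m+d)

  shift-bounded : ∀ x {y} → x < m + d → shift x ≡ just y → y < m + d
  shift-bounded x {y} x<m+d e with shift-spec x e
  ... | inj₁ (x<m , refl) = +-monoˡ-< d x<m
  ... | inj₂ (_ , refl) = ≤-<-trans (m≤m+n y d) x<m+d

  shift-suc : ∀ a {a' b'} → shift a ≡ just a' → shift (suc a) ≡ just b' →
              b' ≡ suc a' ⊎ (suc a' ≡ m + d × b' ≡ 0)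
  shift-suc a {a'} {b'} ea eb with shift-spec a ea | shift-spec (suc a) eb
  ... | inj₁ (_ , refl) | inj₁ (_ , refl) = inj₁ refl
  ... | inj₂ (_ , refl) | inj₂ (_ , e) = inj₁ (+-cancelʳ-≡ d b' (suc a') (sym e))
  ... | inj₂ (m≤a , _) | inj₁ (1+a<m , _) =
    ⊥-elim (<-irrefl refl (≤-trans (s≤s (n≤1+n a)) (≤-trans 1+a<m m≤a)))
  ... | inj₁ (a<m , refl) | inj₂ (m≤1+a , e) = inj₂ (cong (_+ d) 1+a≡m , b'≡0)
    where
      1+a≡m : suc a ≡ m
      1+a≡m = ≤-antisym a<m m≤1+a
      b'≡0 : b' ≡ 0
      b'≡0 = n≤0⇒n≡0 (+-cancelʳ-≤ d b' 0 (subst (_≤ d) (trans (sym 1+a≡m) e) m≤d))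

⌈n/2⌉≤1+⌊n/2⌋ : ∀ n → ⌈ n /2⌉ ≤ suc ⌊ n /2⌋
⌈n/2⌉≤1+⌊n/2⌋ zero          = z≤n
⌈n/2⌉≤1+⌊n/2⌋ (suc zero)    = s≤s z≤n
⌈n/2⌉≤1+⌊n/2⌋ (suc (suc n)) = s≤s (⌈n/2⌉≤1+⌊n/2⌋ n)

∣n-1+n∣≡1 : ∀ n → ∣ n - suc n ∣ ≡ 1
∣n-1+n∣≡1 zero    = refl
∣n-1+n∣≡1 (suc n) = ∣n-1+n∣≡1 n

data Step (a : ℕ) (j : Fin 3) (b : ℕ) (k : Fin 3) : Set where
  across   : b ≡ suc a → k ≡ j → Step a j b k
  up       : b ≡ a → toℕ k ≡ suc (toℕ j) → Step a j b k
  diagonal : b ≡ suc a → toℕ k ≡ suc (toℕ j) → Step a j b k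

step-distance : ∀ {a j b k} → Step a j b k → ∣ a - b ∣ ≤ 1
step-distance {a} (across refl _)   = ≤-reflexive (∣n-1+n∣≡1 a)
step-distance {a} (up refl _)       = subst (_≤ 1) (sym (∣n-n∣≡0 a)) z≤n
step-distance {a} (diagonal refl _) = ≤-reflexive (∣n-1+n∣≡1 a)

vertices : (n : ℕ) → List (GV n)
vertices n = L1 ∷ R2 ∷ R3 ∷ cartesianProductWith cell (allFin n) (allFin 3)

vertices-complete : (n : ℕ) → ∀ v → v ∈ vertices n
vertices-complete n L1 = here refl
vertices-complete n R2 = there (here refl)
vertices-complete n R3 = there (there (here refl))
vertices-complete n (cell i j) =
  there (there (there (∈-cartesianProductWith⁺ cell (∈-allFin i) (∈-allFin j))))

module Board (k : ℕ) where
  n : ℕ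
  n = suc k

  -- Cell i j is placed at (i + 1, j), L1 at (0, 0) and R2, R3 at (n + 1, 1), (n + 1, 2):
  -- G_n is the subgraph of T_{n+2,3} induced by these positions.
  col : GV n → ℕ
  col (cell i _) = suc (toℕ i)
  col L1 = 0
  col R2 = suc n
  col R3 = suc n

  row : GV n → Fin 3
  row (cell _ j) = j
  row L1 = fz
  row R2 = fs fz
  row R3 = fs (fs fz)

  rightEnd : Fin 3 → Maybe (GV n)
  rightEnd fz = nothing
  rightEnd (fs fz) = just R2
  rightEnd (fs (fs fz)) = just R3

  vertexAt : ℕ → Fin 3 → Maybe (GV n)
  vertexAt zero fz = just L1
  vertexAt zero (fs _) = nothing
  vertexAt (suc x) j with x <? n
  ... | yes x<n = just (cell (fromℕ< x<n) j)
  ... | no _ with x ≟ n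
  ...   | yes _ = rightEnd j
  ...   | no _  = nothing

  vertexAt-col-row : ∀ v → vertexAt (col v) (row v) ≡ just v
  vertexAt-col-row (cell i j) with toℕ i <? n
  ... | yes i<n = cong (λ i' → just (cell i' j)) (fromℕ<-toℕ i i<n)
  ... | no i≮n = ⊥-elim (i≮n (toℕ<n i))
  vertexAt-col-row L1 = refl
  vertexAt-col-row R2 with n <? n
  ... | yes n<n = ⊥-elim (n≮n n n<n)
  ... | no _ with n ≟ n
  ...   | yes _ = refl
  ...   | no n≢n = ⊥-elim (n≢n refl)
  vertexAt-col-row R3 with n <? n
  ... | yes n<n = ⊥-elim (n≮n n n<n)
  ... | no _ with n ≟ n
  ...   | yes _ = refl
  ...   | no n≢n = ⊥-elim (n≢n refl)

  vertexAt-col-row⁻ : ∀ {x j v} → vertexAt x j ≡ just v → col v ≡ x × row v ≡ j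
  vertexAt-col-row⁻ {zero} {fz} refl = refl , refl
  vertexAt-col-row⁻ {zero} {fs _} ()
  vertexAt-col-row⁻ {suc x} {j} e with x <? n
  vertexAt-col-row⁻ refl | yes x<n = cong suc (toℕ-fromℕ< x<n) , refl
  ... | no _ with x ≟ n
  vertexAt-col-row⁻ {j = fz} () | no _ | yes _
  vertexAt-col-row⁻ {j = fs fz} refl | no _ | yes refl = refl , refl
  vertexAt-col-row⁻ {j = fs (fs fz)} refl | no _ | yes refl = refl , refl
  vertexAt-col-row⁻ () | no _ | no _

  vertexAt-hole : ∀ {x j} → x ≤ suc n → vertexAt x j ≡ nothing →
                  (x ≡ 0 × j ≢ fz) ⊎ (x ≡ suc n × j ≡ fz)
  vertexAt-hole {zero} {fz} _ ()
  vertexAt-hole {zero} {fs _} _ _ = inj₁ (refl , λ ())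
  vertexAt-hole {suc x} {j} x≤n e with x <? n
  vertexAt-hole _ () | yes _
  ... | no x≮n with x ≟ n
  vertexAt-hole {j = fz} _ _ | no _ | yes refl = inj₂ (refl , refl)
  vertexAt-hole {j = fs fz} _ () | no _ | yes refl
  vertexAt-hole {j = fs (fs fz)} _ () | no _ | yes refl
  ... | no x≢n = ⊥-elim (x≮n (≤∧≢⇒< (≤-pred x≤n) x≢n))

  col≤ : ∀ v → col v ≤ suc n
  col≤ (cell i _) = m≤n⇒m≤1+n (toℕ<n i)
  col≤ L1 = z≤n
  col≤ R2 = ≤-refl
  col≤ R3 = ≤-refl

  col-row-injective : ∀ {u v} → col u ≡ col v → row u ≡ row v → u ≡ v
  col-row-injective {u} {v} c r =
    just-injective (trans (sym (vertexAt-col-row u)) (trans (cong₂ vertexAt c r) (vertexAt-col-row v)))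

  col≡0⇒row≡0 : ∀ {v} → col v ≡ 0 → row v ≡ fz
  col≡0⇒row≡0 {L1} _ = refl

  col≡1+n⇒row≢0 : ∀ {v} → col v ≡ suc n → row v ≢ fz
  col≡1+n⇒row≢0 {cell i _} c _ = <-irrefl (suc-injective c) (toℕ<n i)
  col≡1+n⇒row≢0 {R2} _ ()
  col≡1+n⇒row≢0 {R3} _ ()

  edge⇒step : ∀ {u v} → GEdge n u v → Step (col u) (row u) (col v) (row v)
  edge⇒step (horiz _ _ _ e)    = across (cong suc (sym e)) refl
  edge⇒step (vert _ _ _ e)     = up refl (sym e)
  edge⇒step (diag _ _ _ _ e r) = diagonal (cong suc (sym e)) (sym r)
  edge⇒step (L1-1 _ e)         = across (cong suc e) refl
  edge⇒step (L1-2 _ e)         = diagonal (cong suc e) refl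
  edge⇒step (R2-1 _ e)         = diagonal (cong suc (sym e)) refl
  edge⇒step (R2-2 _ e)         = across (cong suc (sym e)) refl
  edge⇒step (R3-2 _ e)         = diagonal (cong suc (sym e)) refl
  edge⇒step (R3-3 _ e)         = across (cong suc (sym e)) refl
  edge⇒step R2-R3              = up refl refl

  toℕ≢n : ∀ (i : Fin n) → toℕ i ≢ n
  toℕ≢n i e = <-irrefl e (toℕ<n i)

  toℕ≢1+n : ∀ (i : Fin n) → toℕ i ≢ suc n
  toℕ≢1+n i e = <-irrefl e (m≤n⇒m≤1+n (toℕ<n i))

  cell-step⇒edge : ∀ i j v → Step (suc (toℕ i)) j (col v) (row v) → GEdge n (cell i j) v
  cell-step⇒edge i j (cell i' .j) (across e refl) = horiz i i' j (sym (suc-injective e))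
  cell-step⇒edge i j (cell i' j') (up e r) =
    subst (λ i'' → GEdge n (cell i j) (cell i'' j')) (toℕ-injective (suc-injective (sym e)))
          (vert i j j' (sym r))
  cell-step⇒edge i j (cell i' j') (diagonal e r) = diag i i' j j' (sym (suc-injective e)) (sym r)
  cell-step⇒edge i j L1 (across () _)
  cell-step⇒edge i j L1 (up () _)
  cell-step⇒edge i j L1 (diagonal () _)
  cell-step⇒edge i .(fs fz) R2 (across e refl) = R2-2 i (sym (suc-injective e))
  cell-step⇒edge i j R2 (up e _) = ⊥-elim (toℕ≢n i (sym (suc-injective e)))
  cell-step⇒edge i fz R2 (diagonal e _) = R2-1 i (sym (suc-injective e))
  cell-step⇒edge i (fs _) R2 (diagonal _ ())
  cell-step⇒edge i .(fs (fs fz)) R3 (across e refl) = R3-3 i (sym (suc-injective e))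
  cell-step⇒edge i j R3 (up e _) = ⊥-elim (toℕ≢n i (sym (suc-injective e)))
  cell-step⇒edge i fz R3 (diagonal _ ())
  cell-step⇒edge i (fs fz) R3 (diagonal e _) = R3-2 i (sym (suc-injective e))
  cell-step⇒edge i (fs (fs _)) R3 (diagonal _ ())

  L1-step⇒edge : ∀ v → Step 0 fz (col v) (row v) → GEdge n L1 v
  L1-step⇒edge (cell i .fz) (across e refl) = L1-1 i (suc-injective e)
  L1-step⇒edge (cell i j) (up () _)
  L1-step⇒edge (cell i fz) (diagonal _ ())
  L1-step⇒edge (cell i (fs fz)) (diagonal e _) = L1-2 i (suc-injective e)
  L1-step⇒edge (cell i (fs (fs _))) (diagonal _ ())
  L1-step⇒edge L1 (across () _)
  L1-step⇒edge L1 (up _ ())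
  L1-step⇒edge L1 (diagonal () _)
  L1-step⇒edge R2 (across () _)
  L1-step⇒edge R2 (up () _)
  L1-step⇒edge R2 (diagonal () _)
  L1-step⇒edge R3 (across () _)
  L1-step⇒edge R3 (up () _)
  L1-step⇒edge R3 (diagonal () _)

  right-to-cell : ∀ {r} i {j} → ¬ Step (suc n) r (suc (toℕ i)) j
  right-to-cell i (across e _)   = toℕ≢1+n i (suc-injective e)
  right-to-cell i (up e _)       = toℕ≢n i (suc-injective e)
  right-to-cell i (diagonal e _) = toℕ≢1+n i (suc-injective e)

  R2-step⇒edge : ∀ v → Step (suc n) (fs fz) (col v) (row v) → GEdge n R2 v
  R2-step⇒edge (cell i _) s = ⊥-elim (right-to-cell i s)
  R2-step⇒edge L1 (across () _)
  R2-step⇒edge L1 (up () _)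
  R2-step⇒edge L1 (diagonal () _)
  R2-step⇒edge R2 (across () _)
  R2-step⇒edge R2 (up _ ())
  R2-step⇒edge R2 (diagonal () _)
  R2-step⇒edge R3 (across () _)
  R2-step⇒edge R3 (up _ _) = R2-R3
  R2-step⇒edge R3 (diagonal () _)

  R3-step⇒edge : ∀ v → Step (suc n) (fs (fs fz)) (col v) (row v) → GEdge n R3 v
  R3-step⇒edge (cell i _) s = ⊥-elim (right-to-cell i s)
  R3-step⇒edge L1 (across () _)
  R3-step⇒edge L1 (up () _)
  R3-step⇒edge L1 (diagonal () _)
  R3-step⇒edge R2 (across () _)
  R3-step⇒edge R2 (up _ ())
  R3-step⇒edge R2 (diagonal () _)
  R3-step⇒edge R3 (across () _)
  R3-step⇒edge R3 (up _ ())
  R3-step⇒edge R3 (diagonal () _)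

  step⇒edge : ∀ u v → Step (col u) (row u) (col v) (row v) → GEdge n u v
  step⇒edge (cell i j) = cell-step⇒edge i j
  step⇒edge L1 = L1-step⇒edge
  step⇒edge R2 = R2-step⇒edge
  step⇒edge R3 = R3-step⇒edge

  adjacent-distance : ∀ {u v} → GAdj n u v → ∣ col u - col v ∣ ≤ 1
  adjacent-distance (inj₁ e) = step-distance (edge⇒step e)
  adjacent-distance {u} {v} (inj₂ e) =
    subst (_≤ 1) (∣-∣-comm (col v) (col u)) (step-distance (edge⇒step e))

  -- Columns 0 … m - 1 are paired with d … n + 1; when n is odd the middle column m is left unpaired.
  m' m d : ℕ
  m' = ⌊ n /2⌋
  m  = suc m'
  d  = suc ⌈ n /2⌉

  m+d≡2+n : m + d ≡ suc (suc n)
  m+d≡2+n = cong suc (trans (+-suc m' ⌈ n /2⌉) (cong suc (⌊n/2⌋+⌈n/2⌉≡n n)))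

  m≤d : m ≤ d
  m≤d = s≤s (⌊n/2⌋≤⌈n/2⌉ n)

  d≤1+m : d ≤ suc m
  d≤1+m = s≤s (⌈n/2⌉≤1+⌊n/2⌋ n)

  m'<n : m' < n
  m'<n = ⌊n/2⌋<n k

  open ColumnShift m d m≤d

  col<m+d : ∀ v → col v < m + d
  col<m+d v = subst (col v <_) (sym m+d≡2+n) (s≤s (col≤ v))

  mate : GV n → Maybe (GV n)
  mate v with shift (col v)
  ... | just x  = vertexAt x (row v)
  ... | nothing = nothing

  mate-spec : ∀ v {v'} → mate v ≡ just v' → shift (col v) ≡ just (col v') × row v' ≡ row v
  mate-spec v e with shift (col v)
  ... | just x = cong just (sym (proj₁ (vertexAt-col-row⁻ {x} e))) , proj₂ (vertexAt-col-row⁻ {x} e)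
  mate-spec v () | nothing

  mate-intro : ∀ v v' → shift (col v) ≡ just (col v') → row v' ≡ row v → mate v ≡ just v'
  mate-intro v v' s r with shift (col v)
  mate-intro v v' refl r | just _ = subst (λ j → vertexAt (col v') j ≡ just v') r (vertexAt-col-row v')

  mate-distance : ∀ x {y} → mate x ≡ just y → ∣ col x - col y ∣ ≡ d
  mate-distance x e = shift-distance (col x) (proj₁ (mate-spec x e))

  -- When d = m the neighbouring columns m - 1 and m are sent to n + 1 and 0; no step survives this,
  -- since steps never lower the row, column n + 1 is empty in row 0 and column 0 is empty above it.
  step-shift : ∀ {a j b k a' b'} → Step a j b k → shift a ≡ just a' → shift b ≡ just b' →
               (a' ≡ suc n → j ≢ fz) → (b' ≡ 0 → k ≡ fz) → Step a' j b' k
  step-shift (up refl r) sa sb _ _ = up (just-injective (trans (sym sb) sa)) r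
  step-shift {a} (across refl r) sa sb last first with shift-suc a sa sb
  ... | inj₁ b'≡1+a' = across b'≡1+a' r
  ... | inj₂ (c , b'≡0) = ⊥-elim (last (suc-injective (trans c m+d≡2+n)) (trans (sym r) (first b'≡0)))
  step-shift {a} (diagonal refl r) sa sb last first with shift-suc a sa sb
  ... | inj₁ b'≡1+a' = diagonal b'≡1+a' r
  ... | inj₂ (_ , b'≡0) with trans (sym r) (cong toℕ (first b'≡0))
  ...   | ()

  mate-step : ∀ {u v u' v'} → mate u ≡ just u' → mate v ≡ just v' →
              Step (col u) (row u) (col v) (row v) → Step (col u') (row u') (col v') (row v')
  mate-step {u} {v} {u'} {v'} mu mv s =
    subst₂ (λ j k → Step (col u') j (col v') k) (sym ru) (sym rv)
      (step-shift s su sv (λ c → subst (_≢ fz) ru (col≡1+n⇒row≢0 c))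
                          (λ c → trans (sym rv) (col≡0⇒row≡0 c)))
    where
      su = proj₁ (mate-spec u mu)
      ru = proj₂ (mate-spec u mu)
      sv = proj₁ (mate-spec v mv)
      rv = proj₂ (mate-spec v mv)

  mate-irrefl : ∀ {x y} → mate x ≡ just y → y ≢ x
  mate-irrefl {x} e refl with trans (sym (∣n-n∣≡0 (col x))) (mate-distance x e)
  ... | ()

  mate-sym : ∀ {x y} → mate x ≡ just y → mate y ≡ just x
  mate-sym {x} {y} e =
    mate-intro y x (shift-involutive (col x) (col<m+d x) (proj₁ (mate-spec x e))) (sym (proj₂ (mate-spec x e)))

  mate-nonadjacent : ∀ {x y} → mate x ≡ just y → ¬ GAdj n y x
  mate-nonadjacent {x} {y} e adj
    with subst (_≤ 1) (trans (∣-∣-comm (col y) (col x)) (mate-distance x e)) (adjacent-distance adj)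
  ... | s≤s ()

  mate-adjacent : ∀ {x y x' y'} → mate x ≡ just x' → mate y ≡ just y' → GAdj n x y → GAdj n x' y'
  mate-adjacent mx my (inj₁ e) = inj₁ (step⇒edge _ _ (mate-step mx my (edge⇒step e)))
  mate-adjacent mx my (inj₂ e) = inj₂ (step⇒edge _ _ (mate-step my mx (edge⇒step e)))

  open PairingStrategy (_≟G_ {n}) (GAdj n)

  pairing : IsPairing mate
  pairing = record
    { mate-irrefl      = mate-irrefl
    ; mate-sym         = mate-sym
    ; mate-nonadjacent = mate-nonadjacent
    ; mate-adjacent    = mate-adjacent
    }

  centre : GV n
  centre = cell (fromℕ< m'<n) (fs fz)

  col-centre : col centre ≡ m
  col-centre = cong suc (toℕ-fromℕ< m'<n)

  mate-centre : mate centre ≡ nothing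
  mate-centre with mate centre in e
  ... | nothing = refl
  ... | just z
    with shift-spec m (subst (λ x → shift x ≡ just (col z)) col-centre (proj₁ (mate-spec centre e)))
  ...   | inj₁ (m<m , _) = ⊥-elim (<-irrefl refl m<m)
  ...   | inj₂ (_ , m≡z+d)
    with trans (sym (proj₂ (mate-spec centre e)))
               (col≡0⇒row≡0 {z} (n≤0⇒n≡0 (+-cancelʳ-≤ d (col z) 0 (subst (_≤ d) m≡z+d m≤d))))
  ...     | ()

  centre-column : ∀ u → col u ≡ m → u ≡ centre ⊎ GAdj n u centre
  centre-column u c with row u in r
  ... | fz =
    inj₂ (inj₁ (step⇒edge u centre (up (trans col-centre (sym c)) (cong (λ j → suc (toℕ j)) (sym r)))))
  ... | fs fz = inj₁ (col-row-injective (trans c (sym col-centre)) r)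
  ... | fs (fs fz) = inj₂ (inj₂ (step⇒edge centre u (up (trans c (sym col-centre)) (cong toℕ r))))

  next-column : ∀ u → col u ≡ suc m → row u ≢ fz → GAdj n u centre
  next-column u c r≢0 with row u in r
  ... | fz = ⊥-elim (r≢0 refl)
  ... | fs fz = inj₂ (step⇒edge centre u (across (trans c (cong suc (sym col-centre))) r))
  ... | fs (fs fz) = inj₂ (step⇒edge centre u (diagonal (trans c (cong suc (sym col-centre))) (cong toℕ r)))

  previous-column : ∀ u → suc (col u) ≡ m → row u ≡ fz → GAdj n u centre
  previous-column u c r =
    inj₁ (step⇒edge u centre (diagonal (trans col-centre (sym c)) (cong (λ j → suc (toℕ j)) (sym r))))

  unmatched-near-centre : ∀ u → mate u ≡ nothing → u ≡ centre ⊎ GAdj n u centre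
  unmatched-near-centre u e with shift (col u) in s
  ... | nothing = centre-column u (≤-antisym (≤-pred (≤-trans x<d d≤1+m)) m≤x)
    where
      m≤x = proj₁ (shift-undefined (col u) s)
      x<d = proj₂ (shift-undefined (col u) s)
  ... | just y with vertexAt-hole (≤-pred (subst (y <_) m+d≡2+n (shift-bounded (col u) (col<m+d u) s))) e
  ...   | inj₁ (refl , row≢0) with shift-spec (col u) s
  ...     | inj₁ (_ , 0≡u+d) with m+n≡0⇒n≡0 (col u) (sym 0≡u+d)
  ...       | ()
  unmatched-near-centre u e | just y | inj₁ (refl , row≢0) | inj₂ (_ , u≡d) with m≤n⇒m<n∨m≡n m≤d
  ...       | inj₁ m<d = inj₂ (next-column u (trans u≡d (≤-antisym d≤1+m m<d)) row≢0)
  ...       | inj₂ m≡d = centre-column u (trans u≡d (sym m≡d))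
  unmatched-near-centre u e | just y | inj₂ (refl , row≡0) with shift-spec (col u) s
  ...     | inj₁ (_ , 1+n≡u+d) =
    inj₂ (previous-column u (+-cancelʳ-≡ d (suc (col u)) m (trans (cong suc (sym 1+n≡u+d)) (sym m+d≡2+n)))
                            row≡0)
  ...     | inj₂ (_ , u≡1+n+d) = ⊥-elim (m+1+n≰m (suc n) (subst (_≤ suc n) u≡1+n+d (col≤ u)))

  first-player-win : SnortG-FirstPlayerWin n
  first-player-win = wins Left , wins Right
    where
      wins : ∀ p → Snort.WinsMoving (_≟G_ {n}) (GAdj n) p (Snort.empty (_≟G_ {n}) (GAdj n))
      wins p = Mirror.pairing-wins pairing (vertices n) (vertices-complete n) p
                                   centre mate-centre unmatched-near-centre

lemma3p2 : (n : ℕ) → 1 ≤ n → SnortG-FirstPlayerWin n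
lemma3p2 (suc k) _ = Board.first-player-win k
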